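{- Let $\mathbf{A}(x)\in\mathbb{Q}[x]^{m\times n}$ be a matrix whose entries are polynomials of degree at most $H$. Then there exist a polynomial $a(x)\in\mathbb{Q}[x]$ with $\deg a(x)\le H$ and a matrix $\mathbf{B}(x)\in\mathbb{Q}[x]^{m\times(n-1)}$ whose entries have degree at most $2H$ such that $\mathbf{A}(x)$ is row equivalent to the $m\times n$ matrix whose first column is $(a(x),0,\dots,0)^T$ and whose remaining $n-1$ columns form $\mathbf{B}(x)$.
   Context: Two matrices of the same size over $\mathbb{Q}[x]$ are row equivalent if one is obtained from the other by a finite sequence of invertible elementary row operations over $\mathbb{Q}[x]$ (interchanging two rows, adding a $\mathbb{Q}[x]$-multiple of one row to another row, multiplying a row by a nonzero constant). -}

module Defs where

open import Data.Nat using (ℕ; zero; suc; _<_)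
open import Data.Fin using (Fin; zero; suc; _≟_)
open import Data.List using (List; []; _∷_; map)
open import Data.Rational using (ℚ; 0ℚ) renaming (_+_ to _+ℚ_; _*_ to _*ℚ_)
open import Data.Product using (Σ; _×_)
open import Relation.Binary.PropositionalEquality using (_≡_)
open import Relation.Nullary using (¬_; yes; no)
open import Relation.Binary.Construct.Closure.ReflexiveTransitive using (Star)

-- Univariate polynomials over ℚ, as coefficient lists (constant term
-- first).  Different lists may represent the same polynomial (trailing
-- zeros); polynomial equality is equality of all coefficients.

Poly : Set
Poly = List ℚ

coeff : Poly → ℕ → ℚ
coeff []       _       = 0ℚ
coeff (c ∷ _)  zero    = c
coeff (_ ∷ p)  (suc i) = coeff p i

_≈ₚ_ : Poly → Poly → Set
p ≈ₚ q = ∀ i → coeff p i ≡ coeff q i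

0ₚ : Poly
0ₚ = []

_+ₚ_ : Poly → Poly → Poly
[]      +ₚ q       = q
(a ∷ p) +ₚ []      = a ∷ p
(a ∷ p) +ₚ (b ∷ q) = (a +ℚ b) ∷ (p +ₚ q)

_·ₚ_ : ℚ → Poly → Poly
c ·ₚ p = map (c *ℚ_) p

_*ₚ_ : Poly → Poly → Poly
[]      *ₚ q = []
(a ∷ p) *ₚ q = (a ·ₚ q) +ₚ (0ℚ ∷ (p *ₚ q))

-- deg p ≤ H  (the zero polynomial has degree -∞, so satisfies every bound)
DegLe : ℕ → Poly → Set
DegLe H p = ∀ i → H < i → coeff p i ≡ 0ℚ

Matrix : ℕ → ℕ → Set
Matrix m n = Fin m → Fin n → Poly

_≈ₘ_ : ∀ {m n} → Matrix m n → Matrix m n → Set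
A ≈ₘ B = ∀ i j → A i j ≈ₚ B i j

swapRows : ∀ {m n} → Fin m → Fin m → Matrix m n → Matrix m n
swapRows i j A k with k ≟ i | k ≟ j
... | yes _ | _     = A j
... | no _  | yes _ = A i
... | no _  | no _  = A k

addMulRow : ∀ {m n} → Fin m → Fin m → Poly → Matrix m n → Matrix m n
addMulRow i j f A k l with k ≟ i
... | yes _ = A i l +ₚ (f *ₚ A j l)
... | no _  = A k l

scaleRow : ∀ {m n} → Fin m → ℚ → Matrix m n → Matrix m n
scaleRow i c A k l with k ≟ i
... | yes _ = c ·ₚ A i l
... | no _  = A k l

data ElemRowOp {m n : ℕ} : Matrix m n → Matrix m n → Set where
  swap   : ∀ A (i j : Fin m) → ElemRowOp A (swapRows i j A)
  addMul : ∀ A (i j : Fin m) → ¬ i ≡ j → (f : Poly) → ElemRowOp A (addMulRow i j f A)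
  scale  : ∀ A (i : Fin m) (c : ℚ) → ¬ c ≡ 0ℚ → ElemRowOp A (scaleRow i c A)

RowEquiv : ∀ {m n} → Matrix m n → Matrix m n → Set
RowEquiv A C = Σ _ (λ M → Star ElemRowOp A M × M ≈ₘ C)

firstColBlock : ∀ {m n} → Poly → Matrix m n → Matrix m (suc n)
firstColBlock a B zero    zero    = a
firstColBlock a B (suc i) zero    = 0ₚ
firstColBlock a B i       (suc j) = B i j

-- Euclidean elimination on the first column, tracking degrees. Keep a pivot row p whose
-- first entry has exact degree d, while every first-column entry has degree ≤ D
-- (d ≤ D ≤ H). Invariant: the other entries of the pivot row have degree ≤ 2H − D and
-- those of every other row have degree ≤ 2H − d. Cancelling the x^e term (d ≤ e ≤ D) of
-- another row's first entry adds x^(e−d) times the pivot row to it, which has degree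
-- ≤ (e − d) + (2H − D) ≤ 2H − d, so the invariant survives. Once all other first entries
-- have degree < d, either they vanish and we are done, or one of them, of degree e < d,
-- becomes the new pivot with (D, d) := (d, e), and the invariant again carries over.
-- Since d decreases, the process ends with a first column (a, 0, …, 0), deg a ≤ H, and
-- all other entries of degree ≤ 2H.
module Submission where

open import Defs
open import Data.Nat using (ℕ; zero; suc; _+_; _*_; _∸_; _≤_; _<_; z≤n; s≤s; s≤s⁻¹; _≤?_)
import Data.Nat.Properties as ℕ
open import Data.Fin using (Fin; zero; suc; _≟_)
open import Data.Fin.Properties using (any?)
open import Data.List using (List; []; _∷_; allFin)
open import Data.List.Relation.Unary.Any using (here; there)
open import Data.List.Membership.Propositional using (_∉_)
open import Data.List.Membership.Propositional.Properties using (∈-allFin)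
open import Data.Rational.Base using (ℚ; 0ℚ; 1ℚ; -_; 1/_; NonZero; ≢-nonZero) renaming (_+_ to _+ℚ_; _*_ to _*ℚ_)
import Data.Rational.Properties as ℚ
open import Data.Product using (Σ; ∃; _×_; _,_)
open import Data.Sum using (_⊎_; inj₁; inj₂)
open import Data.Unit using (⊤; tt)
open import Data.Empty using (⊥-elim)
open import Relation.Unary using (Decidable)
open import Relation.Nullary using (Dec; yes; no; ¬?; _×-dec_)
open import Relation.Nullary.Decidable using (decidable-stable)
open import Relation.Binary.PropositionalEquality
  using (_≡_; _≢_; refl; sym; trans; cong; cong₂; subst; module ≡-Reasoning)
open import Relation.Binary.Construct.Closure.ReflexiveTransitive using (Star; ε; _◅_; _◅◅_)

[n∸m]+[p∸o]≤p∸m : ∀ {m n o p} → m ≤ n → n ≤ o → o ≤ p → (n ∸ m) + (p ∸ o) ≤ p ∸ m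
[n∸m]+[p∸o]≤p∸m {m} {n} {o} {p} m≤n n≤o o≤p = begin
  (n ∸ m) + (p ∸ o)  ≡⟨ ℕ.+-comm (n ∸ m) (p ∸ o) ⟩
  (p ∸ o) + (n ∸ m)  ≡⟨ ℕ.+-∸-assoc (p ∸ o) m≤n ⟨
  (p ∸ o) + n ∸ m    ≤⟨ ℕ.∸-monoˡ-≤ m (ℕ.+-monoʳ-≤ (p ∸ o) n≤o) ⟩
  (p ∸ o) + o ∸ m    ≡⟨ cong (_∸ m) (ℕ.m∸n+n≡m o≤p) ⟩
  p ∸ m              ∎
  where open ℕ.≤-Reasoning

2*n∸n≡n : ∀ n → 2 * n ∸ n ≡ n
2*n∸n≡n n = trans (ℕ.m+n∸m≡n n (n + 0)) (ℕ.+-identityʳ n)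

x+[-[x/y]]*y≡0 : ∀ x y .{{_ : NonZero y}} → x +ℚ (- (x *ℚ 1/ y)) *ℚ y ≡ 0ℚ
x+[-[x/y]]*y≡0 x y = begin
  x +ℚ (- (x *ℚ 1/ y)) *ℚ y  ≡⟨ cong (x +ℚ_) (ℚ.neg-distribˡ-* (x *ℚ 1/ y) y) ⟨
  x +ℚ - (x *ℚ 1/ y *ℚ y)    ≡⟨ cong (λ z → x +ℚ - z) (ℚ.*-assoc x (1/ y) y) ⟩
  x +ℚ - (x *ℚ (1/ y *ℚ y))  ≡⟨ cong (λ z → x +ℚ - (x *ℚ z)) (ℚ.*-inverseˡ y) ⟩
  x +ℚ - (x *ℚ 1ℚ)           ≡⟨ cong (λ z → x +ℚ - z) (ℚ.*-identityʳ x) ⟩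
  x +ℚ - x                   ≡⟨ ℚ.+-inverseʳ x ⟩
  0ℚ                         ∎
  where open ≡-Reasoning

DegLt : ℕ → Poly → Set
DegLt k p = ∀ i → k ≤ i → coeff p i ≡ 0ℚ

DegLe-weaken : ∀ {a b p} → a ≤ b → DegLe a p → DegLe b p
DegLe-weaken a≤b p≤a i b<i = p≤a i (ℕ.≤-trans (s≤s a≤b) b<i)

DegLt⇒DegLe : ∀ {a b p} → a ≤ b → DegLt a p → DegLe b p
DegLt⇒DegLe a≤b p<a i b<i = p<a i (ℕ.≤-trans a≤b (ℕ.<⇒≤ b<i))

coeff-+ₚ : ∀ p q i → coeff (p +ₚ q) i ≡ coeff p i +ℚ coeff q i
coeff-+ₚ []      q       i       = sym (ℚ.+-identityˡ _)
coeff-+ₚ (a ∷ p) []      i       = sym (ℚ.+-identityʳ _)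
coeff-+ₚ (a ∷ p) (b ∷ q) zero    = refl
coeff-+ₚ (a ∷ p) (b ∷ q) (suc i) = coeff-+ₚ p q i

coeff-·ₚ : ∀ c p i → coeff (c ·ₚ p) i ≡ c *ℚ coeff p i
coeff-·ₚ c []      i       = sym (ℚ.*-zeroʳ c)
coeff-·ₚ c (a ∷ p) zero    = refl
coeff-·ₚ c (a ∷ p) (suc i) = coeff-·ₚ c p i

coeff-0ℚ·ₚ : ∀ p i → coeff (0ℚ ·ₚ p) i ≡ 0ℚ
coeff-0ℚ·ₚ p i = trans (coeff-·ₚ 0ℚ p i) (ℚ.*-zeroˡ (coeff p i))

DegLe-+ₚ : ∀ {a p q} → DegLe a p → DegLe a q → DegLe a (p +ₚ q)
DegLe-+ₚ {p = p} {q} p≤a q≤a i a<i = begin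
  coeff (p +ₚ q) i         ≡⟨ coeff-+ₚ p q i ⟩
  coeff p i +ℚ coeff q i   ≡⟨ cong₂ _+ℚ_ (p≤a i a<i) (q≤a i a<i) ⟩
  0ℚ +ℚ 0ℚ                 ≡⟨ ℚ.+-identityˡ 0ℚ ⟩
  0ℚ                       ∎
  where open ≡-Reasoning

monomial : ℕ → ℚ → Poly
monomial zero    c = c ∷ []
monomial (suc k) c = 0ℚ ∷ monomial k c

coeff-monomial-*ₚ : ∀ k c q j → coeff (monomial k c *ₚ q) (k + j) ≡ c *ℚ coeff q j
coeff-monomial-*ₚ zero c q j = begin
  coeff ((c ·ₚ q) +ₚ (0ℚ ∷ [])) j        ≡⟨ coeff-+ₚ (c ·ₚ q) (0ℚ ∷ []) j ⟩
  coeff (c ·ₚ q) j +ℚ coeff (0ℚ ∷ []) j  ≡⟨ cong (coeff (c ·ₚ q) j +ℚ_) (coeff-[0] j) ⟩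
  coeff (c ·ₚ q) j +ℚ 0ℚ                 ≡⟨ ℚ.+-identityʳ _ ⟩
  coeff (c ·ₚ q) j                       ≡⟨ coeff-·ₚ c q j ⟩
  c *ℚ coeff q j                         ∎
  where
  open ≡-Reasoning
  coeff-[0] : ∀ i → coeff (0ℚ ∷ []) i ≡ 0ℚ
  coeff-[0] zero    = refl
  coeff-[0] (suc i) = refl
coeff-monomial-*ₚ (suc k) c q j = begin
  coeff ((0ℚ ·ₚ q) +ₚ (0ℚ ∷ (monomial k c *ₚ q))) (suc (k + j))
    ≡⟨ coeff-+ₚ (0ℚ ·ₚ q) _ (suc (k + j)) ⟩
  coeff (0ℚ ·ₚ q) (suc (k + j)) +ℚ coeff (monomial k c *ₚ q) (k + j)
    ≡⟨ cong (_+ℚ coeff (monomial k c *ₚ q) (k + j)) (coeff-0ℚ·ₚ q (suc (k + j))) ⟩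
  0ℚ +ℚ coeff (monomial k c *ₚ q) (k + j)
    ≡⟨ ℚ.+-identityˡ _ ⟩
  coeff (monomial k c *ₚ q) (k + j)
    ≡⟨ coeff-monomial-*ₚ k c q j ⟩
  c *ℚ coeff q j
    ∎
  where open ≡-Reasoning

DegLe-monomial-*ₚ : ∀ k c {b q} → DegLe b q → DegLe (k + b) (monomial k c *ₚ q)
DegLe-monomial-*ₚ k c {b} {q} q≤b i k+b<i = begin
  coeff (monomial k c *ₚ q) i              ≡⟨ cong (coeff (monomial k c *ₚ q)) (ℕ.m+[n∸m]≡n k≤i) ⟨
  coeff (monomial k c *ₚ q) (k + (i ∸ k))  ≡⟨ coeff-monomial-*ₚ k c q (i ∸ k) ⟩
  c *ℚ coeff q (i ∸ k)                     ≡⟨ cong (c *ℚ_) (q≤b (i ∸ k) b<i∸k) ⟩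
  c *ℚ 0ℚ                                  ≡⟨ ℚ.*-zeroʳ c ⟩
  0ℚ                                       ∎
  where
  open ≡-Reasoning
  k≤i : k ≤ i
  k≤i = ℕ.≤-trans (ℕ.m≤m+n k b) (ℕ.<⇒≤ k+b<i)
  b<i∸k : b < i ∸ k
  b<i∸k = ℕ.m+n≤o⇒m≤o∸n (suc b) (subst (_≤ i) (cong suc (ℕ.+-comm k b)) k+b<i)

record HasDegree (d : ℕ) (p : Poly) : Set where
  field
    leading≢0 : coeff p d ≢ 0ℚ
    bound     : DegLe d p
open HasDegree

degree-≤ : ∀ {d D p} → HasDegree d p → DegLe D p → d ≤ D
degree-≤ {d} {D} hp p≤D with d ≤? D
... | yes d≤D = d≤D
... | no  d≰D = ⊥-elim (leading≢0 hp (p≤D d (ℕ.≰⇒> d≰D)))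

degree-< : ∀ {d k p} → HasDegree d p → DegLt k p → d < k
degree-< {d} {k} hp p<k with k ≤? d
... | yes k≤d = ⊥-elim (leading≢0 hp (p<k d k≤d))
... | no  k≰d = ℕ.≰⇒> k≰d

data DegreeView (p : Poly) : Set where
  zero-poly : p ≈ₚ 0ₚ → DegreeView p
  degree    : ∀ d → HasDegree d p → DegreeView p

degreeView : ∀ p → DegreeView p
degreeView [] = zero-poly (λ _ → refl)
degreeView (c ∷ p) with degreeView p
... | degree d hp = degree (suc d) record
  { leading≢0 = leading≢0 hp
  ; bound     = λ { zero () ; (suc i) (s≤s d<i) → bound hp i d<i } }
... | zero-poly p≈0 with c ℚ.≟ 0ℚ
...   | yes c≡0 = zero-poly λ { zero → c≡0 ; (suc i) → p≈0 i }
...   | no  c≢0 = degree 0 record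
  { leading≢0 = c≢0
  ; bound     = λ { zero () ; (suc i) _ → p≈0 i } }

isZero? : ∀ p → Dec (p ≈ₚ 0ₚ)
isZero? p with degreeView p
... | zero-poly p≈0 = yes p≈0
... | degree d hp   = no λ p≈0 → leading≢0 hp (p≈0 d)

leadingQuotient : ∀ p e {q d} → HasDegree d q → Poly
leadingQuotient p e {q} {d} hq =
  monomial (e ∸ d) (- (coeff p e *ℚ 1/_ (coeff q d) {{≢-nonZero (leading≢0 hq)}}))

DegLt-cancel-leading : ∀ {d e q} p (hq : HasDegree d q) → d ≤ e → DegLe e p
  → DegLt e (p +ₚ (leadingQuotient p e hq *ₚ q))
DegLt-cancel-leading {d} {e} {q} p hq d≤e p≤e i e≤i = begin
  coeff (p +ₚ (f *ₚ q)) i         ≡⟨ coeff-+ₚ p (f *ₚ q) i ⟩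
  coeff p i +ℚ coeff (f *ₚ q) i   ≡⟨ vanishes (ℕ.m≤n⇒m<n∨m≡n e≤i) ⟩
  0ℚ                              ∎
  where
  open ≡-Reasoning
  lq : ℚ
  lq = coeff q d
  instance
    lq≢0 : NonZero lq
    lq≢0 = ≢-nonZero (leading≢0 hq)
  c : ℚ
  c = - (coeff p e *ℚ 1/ lq)
  f : Poly
  f = leadingQuotient p e hq
  e≡ : (e ∸ d) + d ≡ e
  e≡ = ℕ.m∸n+n≡m d≤e
  fq≤e : DegLe e (f *ₚ q)
  fq≤e = subst (λ b → DegLe b (f *ₚ q)) e≡ (DegLe-monomial-*ₚ (e ∸ d) c (bound hq))
  vanishes : e < i ⊎ e ≡ i → coeff p i +ℚ coeff (f *ₚ q) i ≡ 0ℚ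
  vanishes (inj₁ e<i) rewrite p≤e i e<i | fq≤e i e<i = ℚ.+-identityˡ 0ℚ
  vanishes (inj₂ refl) = begin
    coeff p e +ℚ coeff (f *ₚ q) e            ≡⟨ cong (λ k → coeff p e +ℚ coeff (f *ₚ q) k) e≡ ⟨
    coeff p e +ℚ coeff (f *ₚ q) (e ∸ d + d)  ≡⟨ cong (coeff p e +ℚ_) (coeff-monomial-*ₚ (e ∸ d) c q d) ⟩
    coeff p e +ℚ c *ℚ lq                     ≡⟨ x+[-[x/y]]*y≡0 (coeff p e) lq ⟩
    0ℚ                                       ∎

addMulRow-≢ : ∀ {m n} {i k : Fin m} j f (M : Matrix m n) l → k ≢ i → addMulRow i j f M k l ≡ M k l
addMulRow-≢ {i = i} {k} j f M l k≢i with k ≟ i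
... | yes k≡i = ⊥-elim (k≢i k≡i)
... | no  _   = refl

addMulRow-≡ : ∀ {m n} (i j : Fin m) f (M : Matrix m n) l → addMulRow i j f M i l ≡ M i l +ₚ (f *ₚ M j l)
addMulRow-≡ i j f M l with i ≟ i
... | yes _   = refl
... | no  i≢i = ⊥-elim (i≢i refl)

swapRows-≡ : ∀ {m n} (i j : Fin m) (M : Matrix m n) → swapRows i j M i ≡ M j
swapRows-≡ i j M with i ≟ i
... | yes _   = refl
... | no  i≢i = ⊥-elim (i≢i refl)

swapRows-row : ∀ {m n} (i j : Fin m) (M : Matrix m n) k → ∃ λ r → swapRows i j M k ≡ M r
swapRows-row i j M k with k ≟ i | k ≟ j
... | yes _ | _     = j , refl
... | no  _ | yes _ = i , refl
... | no  _ | no  _ = k , refl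

swapRows-≢ : ∀ {m n} (i j : Fin m) (M : Matrix m n) {k} → k ≢ i
  → ∃ λ r → r ≢ j × swapRows i j M k ≡ M r
swapRows-≢ i j M {k} k≢i with k ≟ i | k ≟ j
... | yes k≡i | _       = ⊥-elim (k≢i k≡i)
... | no  _   | yes k≡j = i , (λ i≡j → k≢i (trans k≡j (sym i≡j))) , refl
... | no  _   | no  k≢j = k , k≢j , refl

leadingRow? : ∀ {m n} (M : Matrix m n) l {P : Fin m → Set} → Decidable P
  → (∃ λ k → P k × ∃ λ e → HasDegree e (M k l)) ⊎ (∀ k → P k → M k l ≈ₚ 0ₚ)
leadingRow? M l P? with any? (λ k → P? k ×-dec ¬? (isZero? (M k l)))
... | no ¬found = inj₂ λ k Pk → decidable-stable (isZero? (M k l)) (λ M≉0 → ¬found (k , Pk , M≉0))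
... | yes (k , Pk , M≉0) with degreeView (M k l)
...   | zero-poly M≈0 = ⊥-elim (M≉0 M≈0)
...   | degree e he   = inj₁ (k , Pk , e , he)

record Cleared {m n} (H : ℕ) (M : Matrix m (suc n)) : Set where
  field
    pivot       : Fin m
    others-zero : ∀ k → k ≢ pivot → M k zero ≈ₚ 0ₚ
    pivot-deg   : DegLe H (M pivot zero)
    rest-deg    : ∀ i j → DegLe (2 * H) (M i (suc j))

cleared⇒blockForm : ∀ {m n H} {A M : Matrix (suc m) (suc n)} → Star ElemRowOp A M → Cleared H M
  → Σ Poly λ a → Σ (Matrix (suc m) n) λ B →
      DegLe H a × (∀ i j → DegLe (2 * H) (B i j)) × RowEquiv A (firstColBlock a B)
cleared⇒blockForm {m} {n} {H} {M = M} A↝M cl =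
  M p zero , B , pivot-deg , B-deg , (M′ , A↝M ◅◅ (swap M zero p ◅ ε) , M′≈block)
  where
  open Cleared cl renaming (pivot to p)
  M′ : Matrix (suc m) (suc n)
  M′ = swapRows zero p M
  B : Matrix (suc m) n
  B i j = M′ i (suc j)
  B-deg : ∀ i j → DegLe (2 * H) (B i j)
  B-deg i j with swapRows-row zero p M i
  ... | r , M′i≡Mr = subst (λ row → DegLe (2 * H) (row (suc j))) (sym M′i≡Mr) (rest-deg r j)
  M′≈block : M′ ≈ₘ firstColBlock (M p zero) B
  M′≈block zero    zero    x = cong (λ row → coeff (row zero) x) (swapRows-≡ zero p M)
  M′≈block (suc i) zero    x with swapRows-≢ zero p M {suc i} (λ ())
  ... | r , r≢p , M′i≡Mr = trans (cong (λ row → coeff (row zero) x) M′i≡Mr) (others-zero r r≢p x)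
  M′≈block zero    (suc j) x = refl
  M′≈block (suc i) (suc j) x = refl

module Elimination {m n : ℕ} (H : ℕ) (A : Matrix m (suc n)) where

  record Invariant (D d : ℕ) (p : Fin m) (M : Matrix m (suc n)) : Set where
    field
      steps       : Star ElemRowOp A M
      d≤D         : d ≤ D
      D≤H         : D ≤ H
      column-deg  : ∀ i → DegLe D (M i zero)
      pivot-deg   : HasDegree d (M p zero)
      pivot-rest  : ∀ j → DegLe (2 * H ∸ D) (M p (suc j))
      others-rest : ∀ i → i ≢ p → ∀ j → DegLe (2 * H ∸ d) (M i (suc j))
  open Invariant

  FirstColumnFixedOff : Fin m → Matrix m (suc n) → Matrix m (suc n) → Set
  FirstColumnFixedOff i M M′ = ∀ r → r ≢ i → M′ r zero ≡ M r zero

  eliminateLeading : ∀ {D d p M} → Invariant D d p M → ∀ {i} → i ≢ p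
    → ∀ {e} → d ≤ e → e ≤ D → DegLe e (M i zero)
    → ∃ λ M′ → Invariant D d p M′ × DegLt e (M′ i zero) × FirstColumnFixedOff i M M′
  eliminateLeading {D} {d} {p} {M} I {i} i≢p {e} d≤e e≤D Mi≤e =
    M′ , I′ , M′i<e , (λ r r≢i → addMulRow-≢ p f M zero r≢i)
    where
    f : Poly
    f = leadingQuotient (M i zero) e (pivot-deg I)
    M′ : Matrix m (suc n)
    M′ = addMulRow i p f M
    p≢i : p ≢ i
    p≢i p≡i = i≢p (sym p≡i)
    on-row : ∀ (P : Poly → Set) {r} l → P (M i l +ₚ (f *ₚ M p l)) → (r ≢ i → P (M r l)) → P (M′ r l)
    on-row P {r} l Pi Pr = by-cases (r ≟ i)
      where
      by-cases : Dec (r ≡ i) → P (M′ r l)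
      by-cases (yes r≡i) = subst (λ k → P (M′ k l)) (sym r≡i) (subst P (sym (addMulRow-≡ i p f M l)) Pi)
      by-cases (no  r≢i) = subst P (sym (addMulRow-≢ p f M l r≢i)) (Pr r≢i)
    cancelled : DegLt e (M i zero +ₚ (f *ₚ M p zero))
    cancelled = DegLt-cancel-leading (M i zero) (pivot-deg I) d≤e Mi≤e
    M′i<e : DegLt e (M′ i zero)
    M′i<e = subst (DegLt e) (sym (addMulRow-≡ i p f M zero)) cancelled
    f·rest : ∀ j → DegLe (2 * H ∸ d) (f *ₚ M p (suc j))
    f·rest j = DegLe-weaken {p = f *ₚ M p (suc j)} ([n∸m]+[p∸o]≤p∸m d≤e e≤D (ℕ.≤-trans (D≤H I) (ℕ.m≤m+n H _)))
      (DegLe-monomial-*ₚ (e ∸ d) _ (pivot-rest I j))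
    I′ : Invariant D d p M′
    I′ = record
      { steps       = steps I ◅◅ (addMul M i p i≢p f ◅ ε)
      ; d≤D         = d≤D I
      ; D≤H         = D≤H I
      ; column-deg  = λ r → on-row (DegLe D) zero (DegLt⇒DegLe {p = M i zero +ₚ (f *ₚ M p zero)} e≤D cancelled)
                                   (λ _ → column-deg I r)
      ; pivot-deg   = subst (HasDegree d) (sym (addMulRow-≢ p f M zero p≢i)) (pivot-deg I)
      ; pivot-rest  = λ j → subst (DegLe (2 * H ∸ D)) (sym (addMulRow-≢ p f M (suc j) p≢i)) (pivot-rest I j)
      ; others-rest = λ r r≢p j → on-row (DegLe (2 * H ∸ d)) (suc j)
                                    (DegLe-+ₚ {p = M i (suc j)} (others-rest I i i≢p j) (f·rest j))
                                    (λ _ → others-rest I r r≢p j)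
      }

  reduceRow : ∀ k {D d p M} → Invariant D d p M → ∀ {i} → i ≢ p → DegLt k (M i zero)
    → ∃ λ M′ → Invariant D d p M′ × DegLt d (M′ i zero) × FirstColumnFixedOff i M M′
  reduceRow zero {M = M} I i≢p Mi<0 = M , I , (λ x _ → Mi<0 x z≤n) , λ _ _ → refl
  reduceRow (suc k) {d = d} {M = M} I {i} i≢p Mi<k+1 with degreeView (M i zero)
  ... | zero-poly Mi≈0 = M , I , (λ x _ → Mi≈0 x) , λ _ _ → refl
  ... | degree e he with d ≤? e
  ...   | no d≰e = M , I , (λ x d≤x → bound he x (ℕ.<-≤-trans (ℕ.≰⇒> d≰e) d≤x)) , λ _ _ → refl
  ...   | yes d≤e with eliminateLeading I i≢p d≤e (degree-≤ he (column-deg I i)) (bound he)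
  ...     | M₁ , I₁ , M₁i<e , fixed₁
    with reduceRow k I₁ i≢p (λ x k≤x → M₁i<e x (ℕ.≤-trans (s≤s⁻¹ (degree-< he Mi<k+1)) k≤x))
  ...       | M₂ , I₂ , M₂i<d , fixed₂ = M₂ , I₂ , M₂i<d , λ r r≢i → trans (fixed₂ r r≢i) (fixed₁ r r≢i)

  reduceRows : ∀ (rows : List (Fin m)) {D d p M} → Invariant D d p M
    → (∀ k → k ≢ p → k ∉ rows → DegLt d (M k zero))
    → ∃ λ M′ → Invariant D d p M′ × (∀ k → k ≢ p → DegLt d (M′ k zero))
  reduceRows [] {M = M} I reduced = M , I , λ k k≢p → reduced k k≢p λ ()
  reduceRows (x ∷ rows) {D} {d} {p} I reduced with x ≟ p
  ... | yes x≡p = reduceRows rows I λ k k≢p k∉rows → reduced k k≢p λ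
          { (here k≡x)     → k≢p (trans k≡x x≡p)
          ; (there k∈rows) → k∉rows k∈rows }
  ... | no x≢p with reduceRow (suc D) I x≢p (column-deg I x)
  ...   | M₁ , I₁ , M₁x<d , fixed = reduceRows rows I₁ reduced₁
    where
    reduced₁ : ∀ k → k ≢ p → k ∉ rows → DegLt d (M₁ k zero)
    reduced₁ k k≢p k∉rows with k ≟ x
    ... | yes refl = M₁x<d
    ... | no  k≢x  = subst (DegLt d) (sym (fixed k k≢x)) (reduced k k≢p λ
          { (here k≡x)     → k≢x k≡x
          ; (there k∈rows) → k∉rows k∈rows })

  finished : ∀ {D d p M} → Invariant D d p M → (∀ k → k ≢ p → M k zero ≈ₚ 0ₚ) → Cleared H M
  finished {D} {d} {p} {M} I zeros = record
    { pivot       = p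
    ; others-zero = zeros
    ; pivot-deg   = DegLe-weaken {p = M p zero} (ℕ.≤-trans (d≤D I) (D≤H I)) (bound (pivot-deg I))
    ; rest-deg    = rest-deg
    }
    where
    rest-deg : ∀ i j → DegLe (2 * H) (M i (suc j))
    rest-deg i j with i ≟ p
    ... | yes refl = DegLe-weaken {p = M i (suc j)} (ℕ.m∸n≤m (2 * H) D) (pivot-rest I j)
    ... | no  i≢p  = DegLe-weaken {p = M i (suc j)} (ℕ.m∸n≤m (2 * H) d) (others-rest I i i≢p j)

  repivot : ∀ {D d p M} → Invariant D d p M → (∀ k → k ≢ p → DegLt d (M k zero))
    → ∀ {k e} → k ≢ p → HasDegree e (M k zero) → Invariant d e k M
  repivot {d = d} {p} {M} I reduced {k} {e} k≢p he = record
    { steps       = steps I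
    ; d≤D         = e≤d
    ; D≤H         = ℕ.≤-trans (d≤D I) (D≤H I)
    ; column-deg  = column-deg′
    ; pivot-deg   = he
    ; pivot-rest  = others-rest I k k≢p
    ; others-rest = others-rest′
    }
    where
    e≤d : e ≤ d
    e≤d = ℕ.<⇒≤ (degree-< he (reduced k k≢p))
    column-deg′ : ∀ r → DegLe d (M r zero)
    column-deg′ r with r ≟ p
    ... | yes refl = bound (pivot-deg I)
    ... | no  r≢p  = DegLt⇒DegLe {p = M r zero} ℕ.≤-refl (reduced r r≢p)
    others-rest′ : ∀ r → r ≢ k → ∀ j → DegLe (2 * H ∸ e) (M r (suc j))
    others-rest′ r _ j with r ≟ p
    ... | yes refl = DegLe-weaken {p = M r (suc j)} (ℕ.∸-monoʳ-≤ (2 * H) (ℕ.≤-trans e≤d (d≤D I))) (pivot-rest I j)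
    ... | no  r≢p  = DegLe-weaken {p = M r (suc j)} (ℕ.∸-monoʳ-≤ (2 * H) e≤d) (others-rest I r r≢p j)

  clear : ∀ F {D d p M} → d < F → Invariant D d p M → ∃ λ M′ → Star ElemRowOp A M′ × Cleared H M′
  clear (suc F) {p = p} (s≤s d≤F) I
    with reduceRows (allFin m) I (λ k _ k∉all → ⊥-elim (k∉all (∈-allFin k)))
  ... | M₁ , I₁ , reduced with leadingRow? M₁ zero (λ k → ¬? (k ≟ p))
  ...   | inj₂ zeros                 = M₁ , steps I₁ , finished I₁ zeros
  ...   | inj₁ (k , k≢p , e , he) =
          clear F (ℕ.<-≤-trans (degree-< he (reduced k k≢p)) d≤F) (repivot I₁ reduced k≢p he)

  initial : (∀ i j → DegLe H (A i j)) → ∀ {k e} → HasDegree e (A k zero) → Invariant H e k A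
  initial A≤H {k} {e} he = record
    { steps       = ε
    ; d≤D         = e≤H
    ; D≤H         = ℕ.≤-refl
    ; column-deg  = λ i → A≤H i zero
    ; pivot-deg   = he
    ; pivot-rest  = λ j → DegLe-weaken {p = A k (suc j)} H≤2H∸H (A≤H k (suc j))
    ; others-rest = λ i _ j → DegLe-weaken {p = A i (suc j)}
                                (ℕ.≤-trans H≤2H∸H (ℕ.∸-monoʳ-≤ (2 * H) e≤H)) (A≤H i (suc j))
    }
    where
    e≤H : e ≤ H
    e≤H = degree-≤ he (A≤H k zero)
    H≤2H∸H : H ≤ 2 * H ∸ H
    H≤2H∸H = ℕ.≤-reflexive (sym (2*n∸n≡n H))

  clearFirstColumn : (∀ i j → DegLe H (A i j)) → Fin m → ∃ λ M → Star ElemRowOp A M × Cleared H M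
  clearFirstColumn A≤H p₀ with leadingRow? A zero {λ _ → ⊤} (λ _ → yes tt)
  ... | inj₁ (k , _ , e , he) = clear (suc H) (s≤s (degree-≤ he (A≤H k zero))) (initial A≤H he)
  ... | inj₂ zeros = A , ε , record
    { pivot       = p₀
    ; others-zero = λ k _ → zeros k tt
    ; pivot-deg   = A≤H p₀ zero
    ; rest-deg    = λ i j → DegLe-weaken {p = A i (suc j)} (ℕ.m≤m+n H _) (A≤H i (suc j))
    }

lemma6p3 : (m n H : ℕ) (A : Matrix m (suc n))
  → (∀ i j → DegLe H (A i j))
  → Σ Poly (λ a → Σ (Matrix m n) (λ B →
      DegLe H a × (∀ i j → DegLe (2 * H) (B i j)) × RowEquiv A (firstColBlock a B)))
lemma6p3 zero    n H A A≤H = [] , (λ ()) , (λ _ _ → refl) , (λ ()) , (A , ε , λ ())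
lemma6p3 (suc m) n H A A≤H with Elimination.clearFirstColumn H A A≤H zero
... | M , A↝M , cleared = cleared⇒blockForm A↝M cleared
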